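{- If $X$ is a walk-regular graph, then $\widehat{M}_A(X)$ has constant diagonal.
   Context: A graph $X$ is walk-regular if for every $k \ge 0$ the matrix $A(X)^k$ has constant diagonal, i.e. the number of closed walks of length $k$ at a vertex does not depend on the vertex. $A(X)$ is the adjacency matrix. For a real symmetric matrix $B = \sum_r \theta_r E_r$ (spectral decomposition over distinct eigenvalues, $E_r$ orthogonal projections onto eigenspaces), the average mixing matrix with respect to $B$ is $\sum_r E_r \circ E_r$, with $\circ$ the entrywise (Schur) product; $\widehat{M}_A(X)$ denotes it for $B = A(X)$. -}

module Defs where

open import Level using (Level)
open import Data.Nat using (ℕ; zero; suc) renaming (_+_ to _+ℕ_; _*_ to _*ℕ_)
open import Data.Fin using (Fin; zero; suc)
open import Data.Bool using (Bool; true; false; if_then_else_)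
open import Data.Product using (Σ; _×_)
open import Relation.Binary.PropositionalEquality using (_≡_; _≢_)
open import Relation.Nullary using (Dec; yes; no)
open import Algebra.Bundles using (CommutativeRing)

record Graph (n : ℕ) : Set where
  field
    adj    : Fin n → Fin n → Bool
    sym    : ∀ i j → adj i j ≡ adj j i
    irrefl : ∀ i → adj i i ≡ false
open Graph public

Matℕ : ℕ → Set
Matℕ n = Fin n → Fin n → ℕ

sumℕ : ∀ {n} → (Fin n → ℕ) → ℕ
sumℕ {zero}  f = 0
sumℕ {suc n} f = f zero +ℕ sumℕ (λ i → f (suc i))

idℕ : ∀ {n} → Matℕ n
idℕ {suc n} zero    zero    = 1
idℕ {suc n} zero    (suc j) = 0
idℕ {suc n} (suc i) zero    = 0
idℕ {suc n} (suc i) (suc j) = idℕ i j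

mulℕ : ∀ {n} → Matℕ n → Matℕ n → Matℕ n
mulℕ M N i j = sumℕ (λ k → M i k *ℕ N k j)

powℕ : ∀ {n} → Matℕ n → ℕ → Matℕ n
powℕ M zero    = idℕ
powℕ M (suc k) = mulℕ M (powℕ M k)

adjMatℕ : ∀ {n} → Graph n → Matℕ n
adjMatℕ X i j = if adj X i j then 1 else 0

WalkRegular : ∀ {n} → Graph n → Set
WalkRegular X = ∀ k a b → powℕ (adjMatℕ X) k a a ≡ powℕ (adjMatℕ X) k b b

module OverRing {c ℓ : Level} (R : CommutativeRing c ℓ) where
  open CommutativeRing R hiding (zero; sym)

  Mat : ℕ → Set c
  Mat n = Fin n → Fin n → Carrier

  sumR : ∀ {n} → (Fin n → Carrier) → Carrier
  sumR {zero}  f = 0#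
  sumR {suc n} f = f zero + sumR (λ i → f (suc i))

  idM : ∀ {n} → Mat n
  idM {suc n} zero    zero    = 1#
  idM {suc n} zero    (suc j) = 0#
  idM {suc n} (suc i) zero    = 0#
  idM {suc n} (suc i) (suc j) = idM i j

  mulM : ∀ {n} → Mat n → Mat n → Mat n
  mulM M N i j = sumR (λ k → M i k * N k j)

  schur : ∀ {n} → Mat n → Mat n → Mat n
  schur M N i j = M i j * N i j

  adjMat : ∀ {n} → Graph n → Mat n
  adjMat X i j = if adj X i j then 1# else 0#

  record SpectralDecomposition {n : ℕ} (B : Mat n) (m : ℕ) : Set (c Level.⊔ ℓ) where
    field
      θ        : Fin m → Carrier
      E        : Fin m → Mat n
      distinct : ∀ r s → r ≢ s → Σ Carrier (λ u → u * (θ r - θ s) ≈ 1#)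
      decomp   : ∀ i j → B i j ≈ sumR (λ r → θ r * E r i j)
      complete : ∀ i j → sumR (λ r → E r i j) ≈ idM i j
      idem     : ∀ r i j → mulM (E r) (E r) i j ≈ E r i j
      orth     : ∀ r s → r ≢ s → ∀ i j → mulM (E r) (E s) i j ≈ 0#
      symm     : ∀ r i j → E r i j ≈ E r j i

  avgMixing : ∀ {n} {B : Mat n} {m} → SpectralDecomposition B m → Mat n
  avgMixing {m = m} D i j = sumR (λ r → schur (E r) (E r) i j)
    where open SpectralDecomposition D

-- Let A = Σ_r θ_r E_r be a spectral decomposition with pairwise invertible
-- differences θ_r - θ_s.  The average mixing matrix has diagonal entries
-- Σ_r E_r(a,a)², so it suffices that every projection E_r has constant
-- diagonal.
--
-- Call M balanced (for A) if A^k M has constant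
--    diagonal for every k.  Balanced matrices are closed under M ↦ A M and
--    under linear combinations, hence under every "linear factor"
--    M ↦ u·(A M) + v·M; the identity is balanced exactly when all powers
--    of A have constant diagonal.
--  * Lagrange interpolation.  A linear factor acts on Σ_t c_t E_t by
--    multiplying c_t by u θ_t + v.  Taking the factors u_s (x - θ_s) with
--    u_s (θ_r - θ_s) = 1 for s ≠ r, their product applied to I is E_r.
--  * Walk counts.  Walk-regularity is a statement about ℕ-valued powers;
--    it is transported to the scalar ring along ℕ → R, k ↦ k × 1#.
--
-- Hence every E_r is balanced, so has constant diagonal, and the theorem
-- follows.

module Submission where

open import Defs hiding (sym)
open import Level using (Level)
open import Data.Nat using (ℕ; zero; suc) renaming (_*_ to _*ℕ_)
open import Data.Fin using (Fin; zero; suc)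
open import Data.Fin.Properties using (_≟_; suc-injective)
open import Data.Bool using (true; false)
open import Data.Product using (_,_; proj₁)
open import Relation.Binary.PropositionalEquality as ≡ using (_≡_; _≢_)
open import Relation.Nullary using (yes; no)
open import Data.Empty using (⊥-elim)
open import Algebra.Bundles using (CommutativeRing)
open import Function using (_∘_)

module _ {c ℓ : Level} (R : CommutativeRing c ℓ) where
  open CommutativeRing R hiding (zero)
  open OverRing R
  open import Relation.Binary.Reasoning.Setoid setoid
  open import Algebra.Properties.Semiring.Sum semiring
    using (sum; sum-cong-≋; sum-cong-≗; ∑-distrib-+; ∑-comm; *-distribˡ-sum; *-distribʳ-sum)
  open import Algebra.Properties.Semiring.Mult semiring using (_×_; ×-homo-+; ×1-homo-*)
  open import Algebra.Properties.Ring ring using (-‿distribʳ-*)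
  open import Algebra.Solver.Ring.NaturalCoefficients.Default commutativeSemiring
    using (solve; _:=_; _:+_; _:*_)

  sumR≡sum : ∀ {n} (f : Fin n → Carrier) → sumR f ≡ sum f
  sumR≡sum {zero}  f = ≡.refl
  sumR≡sum {suc n} f = ≡.cong (f zero +_) (sumR≡sum (f ∘ suc))

  sumR-cong : ∀ {n} {f g : Fin n → Carrier} → (∀ i → f i ≈ g i) → sumR f ≈ sumR g
  sumR-cong {f = f} {g} f≈g = begin
    sumR f ≡⟨ sumR≡sum f ⟩
    sum f  ≈⟨ sum-cong-≋ f≈g ⟩
    sum g  ≡⟨ sumR≡sum g ⟨
    sumR g ∎

  sumR-+ : ∀ {n} (f g : Fin n → Carrier) → sumR (λ i → f i + g i) ≈ sumR f + sumR g
  sumR-+ f g = begin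
    sumR (λ i → f i + g i) ≡⟨ sumR≡sum (λ i → f i + g i) ⟩
    sum (λ i → f i + g i)  ≈⟨ ∑-distrib-+ f g ⟩
    sum f + sum g          ≡⟨ ≡.cong₂ _+_ (sumR≡sum f) (sumR≡sum g) ⟨
    sumR f + sumR g        ∎

  sumR-*ˡ : ∀ {n} x (f : Fin n → Carrier) → x * sumR f ≈ sumR (λ i → x * f i)
  sumR-*ˡ x f = begin
    x * sumR f             ≡⟨ ≡.cong (x *_) (sumR≡sum f) ⟩
    x * sum f              ≈⟨ *-distribˡ-sum x f ⟩
    sum (λ i → x * f i)    ≡⟨ sumR≡sum (λ i → x * f i) ⟨
    sumR (λ i → x * f i)   ∎

  sumR-*ʳ : ∀ {n} x (f : Fin n → Carrier) → sumR f * x ≈ sumR (λ i → f i * x)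
  sumR-*ʳ x f = begin
    sumR f * x             ≡⟨ ≡.cong (_* x) (sumR≡sum f) ⟩
    sum f * x              ≈⟨ *-distribʳ-sum x f ⟩
    sum (λ i → f i * x)    ≡⟨ sumR≡sum (λ i → f i * x) ⟨
    sumR (λ i → f i * x)   ∎

  sumR-swap : ∀ {n m} (h : Fin n → Fin m → Carrier) →
    sumR (λ i → sumR (h i)) ≈ sumR (λ j → sumR (λ i → h i j))
  sumR-swap h = begin
    sumR (λ i → sumR (h i))          ≡⟨ double h ⟩
    sum (λ i → sum (h i))            ≈⟨ ∑-comm h ⟩
    sum (λ j → sum (λ i → h i j))    ≡⟨ double (λ j i → h i j) ⟨
    sumR (λ j → sumR (λ i → h i j))  ∎
    where
    double : ∀ {p q} (k : Fin p → Fin q → Carrier) →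
      sumR (λ i → sumR (k i)) ≡ sum (λ i → sum (k i))
    double k = ≡.trans (sumR≡sum (λ i → sumR (k i))) (sum-cong-≗ (λ i → sumR≡sum (k i)))

  sumR-zero : ∀ {n} {f : Fin n → Carrier} → (∀ i → f i ≈ 0#) → sumR f ≈ 0#
  sumR-zero {zero}  f≈0 = refl
  sumR-zero {suc n} f≈0 = trans (+-cong (f≈0 zero) (sumR-zero (f≈0 ∘ suc))) (+-identityˡ 0#)

  sumR-single : ∀ {n} {f : Fin n → Carrier} (t : Fin n) →
    (∀ s → s ≢ t → f s ≈ 0#) → sumR f ≈ f t
  sumR-single zero    others≈0 =
    trans (+-congˡ (sumR-zero (λ i → others≈0 (suc i) (λ ())))) (+-identityʳ _)
  sumR-single (suc t) others≈0 =
    trans (+-cong (others≈0 zero (λ ()))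
                  (sumR-single t (λ s s≢t → others≈0 (suc s) (s≢t ∘ suc-injective))))
          (+-identityˡ _)

  infix 4 _≋_
  _≋_ : ∀ {n} → Mat n → Mat n → Set ℓ
  M ≋ N = ∀ i j → M i j ≈ N i j

  ConstantDiagonal : ∀ {n} → Mat n → Set ℓ
  ConstantDiagonal M = ∀ a b → M a a ≈ M b b

  idM-diag : ∀ {n} (i : Fin n) → idM i i ≈ 1#
  idM-diag zero    = refl
  idM-diag (suc i) = idM-diag i

  idM-off : ∀ {n} (i j : Fin n) → i ≢ j → idM i j ≈ 0#
  idM-off zero    zero    i≢j = ⊥-elim (i≢j ≡.refl)
  idM-off zero    (suc j) i≢j = refl
  idM-off (suc i) zero    i≢j = refl
  idM-off (suc i) (suc j) i≢j = idM-off i j (i≢j ∘ ≡.cong suc)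

  mulM-idˡ : ∀ {n} (M : Mat n) → mulM idM M ≋ M
  mulM-idˡ M i j =
    trans (sumR-single i (λ s s≢i → trans (*-congʳ (idM-off i s (s≢i ∘ ≡.sym))) (zeroˡ _)))
          (trans (*-congʳ (idM-diag i)) (*-identityˡ _))

  mulM-idʳ : ∀ {n} (M : Mat n) → mulM M idM ≋ M
  mulM-idʳ M i j =
    trans (sumR-single j (λ s s≢j → trans (*-congˡ (idM-off s j s≢j)) (zeroʳ _)))
          (trans (*-congˡ (idM-diag j)) (*-identityʳ _))

  mulM-congˡ : ∀ {n} {M M′ : Mat n} (N : Mat n) → M ≋ M′ → mulM M N ≋ mulM M′ N
  mulM-congˡ N M≋M′ i j = sumR-cong (λ k → *-congʳ (M≋M′ i k))

  mulM-congʳ : ∀ {n} (M : Mat n) {N N′ : Mat n} → N ≋ N′ → mulM M N ≋ mulM M N′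
  mulM-congʳ M N≋N′ i j = sumR-cong (λ k → *-congˡ (N≋N′ k j))

  mulM-assoc : ∀ {n} (P Q N : Mat n) → mulM (mulM P Q) N ≋ mulM P (mulM Q N)
  mulM-assoc P Q N i j = begin
    sumR (λ k → sumR (λ l → P i l * Q l k) * N k j)
      ≈⟨ sumR-cong (λ k → trans (sumR-*ʳ (N k j) (λ l → P i l * Q l k)) (sumR-cong (λ l → *-assoc (P i l) (Q l k) (N k j)))) ⟩
    sumR (λ k → sumR (λ l → P i l * (Q l k * N k j)))
      ≈⟨ sumR-swap (λ k l → P i l * (Q l k * N k j)) ⟩
    sumR (λ l → sumR (λ k → P i l * (Q l k * N k j)))
      ≈⟨ sumR-cong (λ l → sym (sumR-*ˡ (P i l) (λ k → Q l k * N k j))) ⟩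
    sumR (λ l → P i l * sumR (λ k → Q l k * N k j)) ∎

  mulM-combination : ∀ {n} (P M N : Mat n) x y →
    mulM P (λ i j → x * M i j + y * N i j) ≋ (λ i j → x * mulM P M i j + y * mulM P N i j)
  mulM-combination P M N x y i j = begin
    sumR (λ k → P i k * (x * M k j + y * N k j))
      ≈⟨ sumR-cong (λ k → regroup (P i k) x (M k j) y (N k j)) ⟩
    sumR (λ k → x * (P i k * M k j) + y * (P i k * N k j))
      ≈⟨ sumR-+ (λ k → x * (P i k * M k j)) (λ k → y * (P i k * N k j)) ⟩
    sumR (λ k → x * (P i k * M k j)) + sumR (λ k → y * (P i k * N k j))
      ≈⟨ +-cong (sumR-*ˡ x (λ k → P i k * M k j)) (sumR-*ˡ y (λ k → P i k * N k j)) ⟨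
    x * mulM P M i j + y * mulM P N i j ∎
    where
    regroup : ∀ p x m y n → p * (x * m + y * n) ≈ x * (p * m) + y * (p * n)
    regroup = solve 5 (λ p x m y n → p :* (x :* m :+ y :* n) := x :* (p :* m) :+ y :* (p :* n)) refl

  mulM-sumʳ : ∀ {n m} (P : Mat n) (cf : Fin m → Carrier) (E : Fin m → Mat n) →
    mulM P (λ i j → sumR (λ t → cf t * E t i j)) ≋ (λ i j → sumR (λ t → cf t * mulM P (E t) i j))
  mulM-sumʳ P cf E i j = begin
    sumR (λ k → P i k * sumR (λ t → cf t * E t k j))
      ≈⟨ sumR-cong (λ k → trans (sumR-*ˡ (P i k) (λ t → cf t * E t k j)) (sumR-cong (λ t → swap-left (P i k) (cf t) (E t k j)))) ⟩
    sumR (λ k → sumR (λ t → cf t * (P i k * E t k j)))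
      ≈⟨ sumR-swap (λ k t → cf t * (P i k * E t k j)) ⟩
    sumR (λ t → sumR (λ k → cf t * (P i k * E t k j)))
      ≈⟨ sumR-cong (λ t → sym (sumR-*ˡ (cf t) (λ k → P i k * E t k j))) ⟩
    sumR (λ t → cf t * mulM P (E t) i j) ∎
    where
    swap-left : ∀ p x e → p * (x * e) ≈ x * (p * e)
    swap-left = solve 3 (λ p x e → p :* (x :* e) := x :* (p :* e)) refl

  mulM-sumˡ : ∀ {n m} (N : Mat n) (cf : Fin m → Carrier) (E : Fin m → Mat n) →
    mulM (λ i j → sumR (λ t → cf t * E t i j)) N ≋ (λ i j → sumR (λ t → cf t * mulM (E t) N i j))
  mulM-sumˡ N cf E i j = begin
    sumR (λ k → sumR (λ t → cf t * E t i k) * N k j)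
      ≈⟨ sumR-cong (λ k → trans (sumR-*ʳ (N k j) (λ t → cf t * E t i k)) (sumR-cong (λ t → *-assoc (cf t) (E t i k) (N k j)))) ⟩
    sumR (λ k → sumR (λ t → cf t * (E t i k * N k j)))
      ≈⟨ sumR-swap (λ k t → cf t * (E t i k * N k j)) ⟩
    sumR (λ t → sumR (λ k → cf t * (E t i k * N k j)))
      ≈⟨ sumR-cong (λ t → sym (sumR-*ˡ (cf t) (λ k → E t i k * N k j))) ⟩
    sumR (λ t → cf t * mulM (E t) N i j) ∎

  powR : ∀ {n} → Mat n → ℕ → Mat n
  powR M zero    = idM
  powR M (suc k) = mulM M (powR M k)

  powR-comm : ∀ {n} (A : Mat n) k → mulM (powR A k) A ≋ mulM A (powR A k)
  powR-comm A zero    i j = trans (mulM-idˡ A i j) (sym (mulM-idʳ A i j))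
  powR-comm A (suc k) i j = trans (mulM-assoc A (powR A k) A i j) (mulM-congʳ A (powR-comm A k) i j)

  record LinearFactor : Set c where
    constructor linear
    field
      slope  : Carrier
      offset : Carrier

  _at_ : LinearFactor → Carrier → Carrier
  linear u v at θ = u * θ + v

  applyFactor : ∀ {n} → Mat n → LinearFactor → Mat n → Mat n
  applyFactor A (linear u v) M i j = u * mulM A M i j + v * M i j

  -- The product of the factors f₀ ⋯ f_{k-1} evaluated at A, i.e. applied to I.
  factorProduct : ∀ {n k} → Mat n → (Fin k → LinearFactor) → Mat n
  factorProduct {k = zero}  A fs = idM
  factorProduct {k = suc k} A fs = applyFactor A (fs zero) (factorProduct A (fs ∘ suc))

  prodR : ∀ {k} → (Fin k → Carrier) → Carrier
  prodR {zero}  f = 1#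
  prodR {suc k} f = f zero * prodR (f ∘ suc)

  prodR-zero : ∀ {k} (f : Fin k → Carrier) (i : Fin k) → f i ≈ 0# → prodR f ≈ 0#
  prodR-zero f zero    fi≈0 = trans (*-congʳ fi≈0) (zeroˡ _)
  prodR-zero f (suc i) fi≈0 = trans (*-congˡ (prodR-zero (f ∘ suc) i fi≈0)) (zeroʳ _)

  prodR-one : ∀ {k} (f : Fin k → Carrier) → (∀ i → f i ≈ 1#) → prodR f ≈ 1#
  prodR-one {zero}  f f≈1 = refl
  prodR-one {suc k} f f≈1 = trans (*-cong (f≈1 zero) (prodR-one (f ∘ suc) (f≈1 ∘ suc))) (*-identityˡ 1#)

  module Balance {n : ℕ} (A : Mat n) where

    Balanced : Mat n → Set ℓ
    Balanced M = ∀ k → ConstantDiagonal (mulM (powR A k) M)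

    balanced-cong : ∀ {M N} → M ≋ N → Balanced M → Balanced N
    balanced-cong {M} {N} M≋N bal k a b =
      trans (sym (mulM-congʳ (powR A k) M≋N a a))
            (trans (bal k a b) (mulM-congʳ (powR A k) M≋N b b))

    balanced-diagonal : ∀ {M} → Balanced M → ConstantDiagonal M
    balanced-diagonal {M} bal a b = trans (sym (mulM-idˡ M a a)) (trans (bal zero a b) (mulM-idˡ M b b))

    -- A^k (A M) = A^(k+1) M, so balance passes from M to A M.
    balanced-mulA : ∀ {M} → Balanced M → Balanced (mulM A M)
    balanced-mulA {M} bal k a b = trans (shift a) (trans (bal (suc k) a b) (sym (shift b)))
      where
      shift : ∀ i → mulM (powR A k) (mulM A M) i i ≈ mulM (powR A (suc k)) M i i
      shift i = trans (sym (mulM-assoc (powR A k) A M i i)) (mulM-congˡ M (powR-comm A k) i i)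

    balanced-combination : ∀ {M N} x y → Balanced M → Balanced N →
      Balanced (λ i j → x * M i j + y * N i j)
    balanced-combination {M} {N} x y balM balN k a b =
      trans (mulM-combination (powR A k) M N x y a a)
        (trans (+-cong (*-congˡ (balM k a b)) (*-congˡ (balN k a b)))
               (sym (mulM-combination (powR A k) M N x y b b)))

    balanced-factor : ∀ f {M} → Balanced M → Balanced (applyFactor A f M)
    balanced-factor (linear u v) bal = balanced-combination u v (balanced-mulA bal) bal

    balanced-factorProduct : (∀ k → ConstantDiagonal (powR A k)) →
      ∀ {k} (fs : Fin k → LinearFactor) → Balanced (factorProduct A fs)
    balanced-factorProduct powers {zero} fs k a b =
      trans (mulM-idʳ (powR A k) a a) (trans (powers k a b) (sym (mulM-idʳ (powR A k) b b)))
    balanced-factorProduct powers {suc _} fs =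
      balanced-factor (fs zero) (balanced-factorProduct powers (fs ∘ suc))

  module Interpolation {n m : ℕ} {A : Mat n} (D : SpectralDecomposition A m) where
    open SpectralDecomposition D

    eigen : ∀ t → mulM A (E t) ≋ (λ i j → θ t * E t i j)
    eigen t i j = begin
      mulM A (E t) i j
        ≈⟨ mulM-congˡ (E t) decomp i j ⟩
      mulM (λ i j → sumR (λ r → θ r * E r i j)) (E t) i j
        ≈⟨ mulM-sumˡ (E t) θ E i j ⟩
      sumR (λ r → θ r * mulM (E r) (E t) i j)
        ≈⟨ sumR-single t (λ r r≢t → trans (*-congˡ (orth r t r≢t i j)) (zeroʳ _)) ⟩
      θ t * mulM (E t) (E t) i j
        ≈⟨ *-congˡ (idem t i j) ⟩
      θ t * E t i j ∎

    Expands : (Fin m → Carrier) → Mat n → Set ℓ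
    Expands cf M = M ≋ (λ i j → sumR (λ t → cf t * E t i j))

    expands-id : Expands (λ _ → 1#) idM
    expands-id i j = trans (sym (complete i j)) (sumR-cong (λ t → sym (*-identityˡ (E t i j))))

    expands-factor : ∀ f {cf M} → Expands cf M → Expands (λ t → (f at θ t) * cf t) (applyFactor A f M)
    expands-factor (linear u v) {cf} {M} M≋ i j = begin
      u * mulM A M i j + v * M i j
        ≈⟨ +-cong (*-congˡ AM≋) (*-congˡ (M≋ i j)) ⟩
      u * sumR (λ t → cf t * (θ t * E t i j)) + v * sumR (λ t → cf t * E t i j)
        ≈⟨ +-cong (sumR-*ˡ u (λ t → cf t * (θ t * E t i j))) (sumR-*ˡ v (λ t → cf t * E t i j)) ⟩
      sumR (λ t → u * (cf t * (θ t * E t i j))) + sumR (λ t → v * (cf t * E t i j))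
        ≈⟨ sumR-+ (λ t → u * (cf t * (θ t * E t i j))) (λ t → v * (cf t * E t i j)) ⟨
      sumR (λ t → u * (cf t * (θ t * E t i j)) + v * (cf t * E t i j))
        ≈⟨ sumR-cong (λ t → collect u (θ t) v (cf t) (E t i j)) ⟩
      sumR (λ t → ((u * θ t + v) * cf t) * E t i j) ∎
      where
      AM≋ : mulM A M i j ≈ sumR (λ t → cf t * (θ t * E t i j))
      AM≋ = trans (mulM-congʳ A M≋ i j)
                  (trans (mulM-sumʳ A cf E i j) (sumR-cong (λ t → *-congˡ (eigen t i j))))
      collect : ∀ u θ v x e → u * (x * (θ * e)) + v * (x * e) ≈ ((u * θ + v) * x) * e
      collect = solve 5 (λ u θ v x e → u :* (x :* (θ :* e)) :+ v :* (x :* e) := ((u :* θ :+ v) :* x) :* e) refl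

    expands-factorProduct : ∀ {k} (fs : Fin k → LinearFactor) →
      Expands (λ t → prodR (λ i → fs i at θ t)) (factorProduct A fs)
    expands-factorProduct {zero}  fs = expands-id
    expands-factorProduct {suc k} fs = expands-factor (fs zero) (expands-factorProduct (fs ∘ suc))

    lagrangeFactor : Fin m → Fin m → LinearFactor
    lagrangeFactor r s with s ≟ r
    ... | yes _  = linear 0# 1#
    ... | no s≢r = let u = proj₁ (distinct r s (s≢r ∘ ≡.sym)) in linear u (- (u * θ s))

    lagrange-at-r : ∀ r s → lagrangeFactor r s at θ r ≈ 1#
    lagrange-at-r r s with s ≟ r
    ... | yes _  = trans (+-congʳ (zeroˡ _)) (+-identityˡ _)
    ... | no s≢r = let (u , u·gap≈1) = distinct r s (s≢r ∘ ≡.sym) in begin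
      u * θ r + - (u * θ s)   ≈⟨ +-congˡ (-‿distribʳ-* u (θ s)) ⟩
      u * θ r + u * - θ s     ≈⟨ distribˡ u (θ r) (- θ s) ⟨
      u * (θ r - θ s)         ≈⟨ u·gap≈1 ⟩
      1#                      ∎

    lagrange-at-s : ∀ r s → s ≢ r → lagrangeFactor r s at θ s ≈ 0#
    lagrange-at-s r s s≢r with s ≟ r
    ... | yes s≡r = ⊥-elim (s≢r s≡r)
    ... | no _    = -‿inverseʳ _

    projection-interpolated : ∀ r → factorProduct A (lagrangeFactor r) ≋ E r
    projection-interpolated r i j = begin
      factorProduct A (lagrangeFactor r) i j
        ≈⟨ expands-factorProduct (lagrangeFactor r) i j ⟩
      sumR (λ t → weight t * E t i j)
        ≈⟨ sumR-single r (λ t t≢r → trans (*-congʳ (prodR-zero _ t (lagrange-at-s r t t≢r))) (zeroˡ _)) ⟩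
      weight r * E r i j
        ≈⟨ *-congʳ (prodR-one _ (lagrange-at-r r)) ⟩
      1# * E r i j
        ≈⟨ *-identityˡ _ ⟩
      E r i j ∎
      where
      weight : Fin m → Carrier
      weight t = prodR (λ s → lagrangeFactor r s at θ t)

  avgMixing-constantDiagonal : ∀ {n m} {A : Mat n} → (∀ k → ConstantDiagonal (powR A k)) →
    (D : SpectralDecomposition A m) → ConstantDiagonal (avgMixing D)
  avgMixing-constantDiagonal {A = A} powers D a b =
    sumR-cong (λ r → let Err = projection-diagonal r a b in *-cong Err Err)
    where
    open Balance A
    open Interpolation D
    open SpectralDecomposition D using (E)
    projection-diagonal : ∀ r → ConstantDiagonal (E r)
    projection-diagonal r = balanced-diagonal
      (balanced-cong (projection-interpolated r) (balanced-factorProduct powers (lagrangeFactor r)))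

  ι : ℕ → Carrier
  ι k = k × 1#

  ι-sum : ∀ {n} (f : Fin n → ℕ) → ι (sumℕ f) ≈ sumR (ι ∘ f)
  ι-sum {zero}  f = refl
  ι-sum {suc n} f = trans (×-homo-+ 1# (f zero) _) (+-congˡ (ι-sum (f ∘ suc)))

  ι-id : ∀ {n} (i j : Fin n) → ι (idℕ i j) ≈ idM i j
  ι-id zero    zero    = +-identityʳ 1#
  ι-id zero    (suc j) = refl
  ι-id (suc i) zero    = refl
  ι-id (suc i) (suc j) = ι-id i j

  ι-adj : ∀ {n} (X : Graph n) i j → ι (adjMatℕ X i j) ≈ adjMat X i j
  ι-adj X i j with adj X i j
  ... | true  = +-identityʳ 1#
  ... | false = refl

  ι-pow : ∀ {n} (X : Graph n) k i j → ι (powℕ (adjMatℕ X) k i j) ≈ powR (adjMat X) k i j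
  ι-pow X zero    i j = ι-id i j
  ι-pow X (suc k) i j = trans (ι-sum (λ l → adjMatℕ X i l *ℕ powℕ (adjMatℕ X) k l j)) (sumR-cong (λ l →
    trans (×1-homo-* (adjMatℕ X i l) (powℕ (adjMatℕ X) k l j)) (*-cong (ι-adj X i l) (ι-pow X k l j))))

  walkRegular-powers : ∀ {n} (X : Graph n) → WalkRegular X →
    ∀ k → ConstantDiagonal (powR (adjMat X) k)
  walkRegular-powers X walkReg k a b =
    trans (sym (ι-pow X k a a)) (trans (reflexive (≡.cong ι (walkReg k a b))) (ι-pow X k b b))

mainTheorem8 : ∀ {c ℓ : Level} (R : CommutativeRing c ℓ) (n : ℕ) (X : Graph n) →
    WalkRegular X →
    (m : ℕ) (D : OverRing.SpectralDecomposition R (OverRing.adjMat R X) m) →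
    ∀ a b → CommutativeRing._≈_ R (OverRing.avgMixing R D a a) (OverRing.avgMixing R D b b)
mainTheorem8 R n X walkReg m D =
  avgMixing-constantDiagonal R (walkRegular-powers R X walkReg) D
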